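{- Let $a\in\mathbb{Z}/m\mathbb{Z}$ be neither zero nor a unit, and let $G$ be a connected finite graph with vertices ordered $v_1,\dots,v_n$ in which every edge is labeled $\langle a\rangle$. For each $j$ let $e_j\in(\mathbb{Z}/m\mathbb{Z})^{n}$ be the vertex-labeling that is $1$ at $v_j$ and $0$ elsewhere, and let $\mathbf{1}$ be the vertex-labeling that is $1$ at every vertex. Then \[\{\mathbf{1},\ a e_1,\ a e_2,\ \dots,\ a e_{n-1}\}\] is a minimum generating set of the $\mathbb{Z}$-module $R_G$ of splines on $G$ over $\mathbb{Z}/m\mathbb{Z}$.
   Context: For a finite graph $G=(V,E)$ with edge-labeling $\alpha$ by ideals of $R=\mathbb{Z}/m\mathbb{Z}$, a spline is $f\in R^{|V|}$ with $f_u-f_v\in\alpha(uv)$ for every edge $uv$; $R_G$ is the set of splines. A minimum generating set is a generating set with the smallest possible number of elements. -}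

module Defs where

open import Data.Nat using (ℕ; suc)
open import Data.Integer using (ℤ; +_; _+_; _-_; _*_)
open import Data.Integer.Divisibility using (_∣_)
open import Data.Fin using (Fin; zero; suc; _≟_; inject₁)
open import Data.Product using (_×_; _,_; ∃)
open import Data.Sum using (_⊎_)
open import Data.List using (List)
open import Data.List.Membership.Propositional using (_∈_)
open import Relation.Binary.Construct.Closure.ReflexiveTransitive using (Star)
open import Relation.Nullary using (¬_; does)
open import Data.Bool using (if_then_else_)

-- Elements of ℤ/mℤ are represented by integers; equality in ℤ/mℤ is
-- congruence modulo m.
_≡[_]_ : ℤ → ℕ → ℤ → Set
x ≡[ m ] y = (+ m) ∣ (x - y)

IsZeroMod : ℕ → ℤ → Set
IsZeroMod m a = a ≡[ m ] (+ 0)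

IsUnitMod : ℕ → ℤ → Set
IsUnitMod m a = ∃ λ b → (a * b) ≡[ m ] (+ 1)

InIdeal : ℕ → ℤ → ℤ → Set
InIdeal m a x = ∃ λ r → x ≡[ m ] (r * a)

Graph : ℕ → Set
Graph n = List (Fin n × Fin n)

Adj : ∀ {n} → Graph n → Fin n → Fin n → Set
Adj E u v = ((u , v) ∈ E) ⊎ ((v , u) ∈ E)

Connected : ∀ {n} → Graph n → Set
Connected E = ∀ u v → Star (Adj E) u v

Labeling : ℕ → Set
Labeling n = Fin n → ℤ

IsSpline : ∀ {n} → ℕ → ℤ → Graph n → Labeling n → Set
IsSpline m a E f = ∀ {u v} → (u , v) ∈ E → InIdeal m a (f u - f v)

sumᶠ : ∀ {r} → (Fin r → ℤ) → ℤ
sumᶠ {ℕ.zero} f = + 0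
sumᶠ {suc r} f = f zero + sumᶠ (λ i → f (suc i))

InSpan : ∀ {n r} → ℕ → (Fin r → Labeling n) → Labeling n → Set
InSpan {n} {r} m g f =
  ∃ λ (c : Fin r → ℤ) → ∀ (i : Fin n) → f i ≡[ m ] sumᶠ (λ j → c j * g j i)

Generates : ∀ {n r} → ℕ → ℤ → Graph n → (Fin r → Labeling n) → Set
Generates m a E g =
  (∀ j → IsSpline m a E (g j)) × (∀ f → IsSpline m a E f → InSpan m g f)

e : ∀ {n} → Fin n → Labeling n
e j i = if does (j ≟ i) then + 1 else + 0

one : ∀ {n} → Labeling n
one i = + 1

stdGens : ∀ {k} → ℤ → Fin (suc k) → Labeling (suc k)
stdGens a zero = one
stdGens a (suc j) = λ i → a * e (inject₁ j) i

module Submission where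

-- Along any walk the values of a spline differ by an element
-- of ⟨a⟩, so a spline f satisfies f(vᵢ) ≡ f(vₙ) + rᵢ·a for every vertex vᵢ;
-- hence f = f(vₙ)·𝟏 + Σᵢ rᵢ·(a eᵢ), and 𝟏, a e₁, …, a eₙ₋₁ generate R_G.
--
-- Since a ≢ 0 there is a prime p ∣ m such that m ∣ a·X forces
-- p ∣ X.  Sending a spline f to its coordinates (f(v₀), r₁, …, rₙ₋₁), where
-- f(vᵢ) − f(v₀) ≡ rᵢ·a, gives a map R_G → (ℤ/pℤ)ⁿ that is well defined and
-- ℤ-linear (slopes are unique modulo p) and surjective (the labelling
-- v₀ + a·t has coordinates (v₀, t)).  A generating set of R_G is therefore
-- mapped to a spanning family of (ℤ/pℤ)ⁿ, which has at least n members by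
-- Gaussian elimination, carried out with integers modulo p.

open import Defs
open import Data.Nat using (ℕ; suc; _≤_)
open import Data.Integer using (ℤ)
open import Data.Fin using (Fin)
open import Data.Product using (_×_)
open import Relation.Nullary using (¬_)

open import Data.Nat using (zero; z≤n; s≤s)
import Data.Nat as ℕ
import Data.Nat.Properties as ℕₚ
import Data.Nat.Divisibility as ℕᵈ
open import Data.Nat.GCD using (GCD; mkGCD; GCD-*)
open import Data.Nat.Coprimality using (GCD≡1⇒coprime; coprime-divisor)
  renaming (sym to coprime-sym)
open import Data.Nat.Primality using (Prime; euclidsLemma; prime[2]; prime⇒nonTrivial)
open import Data.Nat.Primality.Factorisation using (factorise; PrimeFactorisation)
open import Data.Nat.ListAction using (product)
open import Data.Nat.Tactic.RingSolver as ℕRing using ()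
open import Data.Integer using (+_; _+_; _-_; _*_; -_; ∣_∣)
open import Data.Integer.Properties
  using (abs-*; +-identityˡ; +-identityʳ; +-inverseʳ; *-zeroʳ; *-distribˡ-+; *-distribʳ-+)
open import Data.Integer.Divisibility.Signed
  using (_∣_; divides; ∣ᵤ⇒∣; ∣⇒∣ᵤ; _∣?_; ∣-trans; ∣m∣n⇒∣m+n; ∣m∣n⇒∣m-n;
         ∣m⇒∣-m; ∣n⇒∣m*n; ∣m⇒∣m*n; module ∣-Reasoning)
open import Data.Integer.Tactic.RingSolver using (solve-∀)
open import Data.Fin using (zero; suc; punchIn; inject₁; fromℕ)
open import Data.Fin.Properties using (¬∀⟶∃¬)
open import Data.List using ([]; _∷_)
open import Data.List.Relation.Unary.All using (_∷_)
open import Data.Product using (_,_; ∃; proj₁; proj₂)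
open import Data.Sum using (_⊎_; inj₁; inj₂)
open import Data.Empty using (⊥-elim)
open import Relation.Binary.PropositionalEquality
open import Relation.Binary.Construct.Closure.ReflexiveTransitive using (Star; ε; _◅_)

sumᶠ-cong : ∀ {r} {f g : Fin r → ℤ} → (∀ i → f i ≡ g i) → sumᶠ f ≡ sumᶠ g
sumᶠ-cong {ℕ.zero} f≡g = refl
sumᶠ-cong {suc r}  f≡g = cong₂ _+_ (f≡g zero) (sumᶠ-cong (λ i → f≡g (suc i)))

sumᶠ-vanishing : ∀ {r} {f : Fin r → ℤ} → (∀ i → f i ≡ + 0) → sumᶠ f ≡ + 0
sumᶠ-vanishing {ℕ.zero} f≡0 = refl
sumᶠ-vanishing {suc r}  f≡0 =
  cong₂ _+_ (f≡0 zero) (sumᶠ-vanishing (λ i → f≡0 (suc i)))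

sumᶠ-sub : ∀ {r} (f g : Fin r → ℤ) → sumᶠ (λ i → f i - g i) ≡ sumᶠ f - sumᶠ g
sumᶠ-sub {ℕ.zero} f g = refl
sumᶠ-sub {suc r}  f g =
  trans (cong (_+_ (f zero - g zero)) (sumᶠ-sub (λ i → f (suc i)) (λ i → g (suc i))))
        (interchange (f zero) (g zero) _ _)
  where
  interchange : ∀ x y s t → x - y + (s - t) ≡ x + s - (y + t)
  interchange = solve-∀

sumᶠ-*ˡ : ∀ {r} (x : ℤ) (f : Fin r → ℤ) → sumᶠ (λ i → x * f i) ≡ x * sumᶠ f
sumᶠ-*ˡ {ℕ.zero} x f = sym (*-zeroʳ x)
sumᶠ-*ˡ {suc r}  x f =
  trans (cong (_+_ (x * f zero)) (sumᶠ-*ˡ x (λ i → f (suc i))))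
        (sym (*-distribˡ-+ x (f zero) _))

sumᶠ-*ʳ : ∀ {r} (f : Fin r → ℤ) (y : ℤ) → sumᶠ (λ i → f i * y) ≡ sumᶠ f * y
sumᶠ-*ʳ {ℕ.zero} f y = refl
sumᶠ-*ʳ {suc r}  f y =
  trans (cong (_+_ (f zero * y)) (sumᶠ-*ʳ (λ i → f (suc i)) y))
        (sym (*-distribʳ-+ y (f zero) _))

sumᶠ-lincomb-diff : ∀ {r} (c x y z : Fin r → ℤ) (a : ℤ) →
  sumᶠ (λ j → c j * (x j - y j - z j * a))
    ≡ sumᶠ (λ j → c j * x j) - sumᶠ (λ j → c j * y j) - sumᶠ (λ j → c j * z j) * a
sumᶠ-lincomb-diff {r} c x y z a = begin
  sumᶠ (λ j → c j * (x j - y j - z j * a))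
    ≡⟨ sumᶠ-cong (λ j → distribute (c j) (x j) (y j) (z j) a) ⟩
  sumᶠ (λ j → (c j * x j - c j * y j) - c j * z j * a)
    ≡⟨ sumᶠ-sub {r} _ _ ⟩
  sumᶠ (λ j → c j * x j - c j * y j) - sumᶠ (λ j → c j * z j * a)
    ≡⟨ cong₂ _-_ (sumᶠ-sub {r} _ _) (sumᶠ-*ʳ {r} _ a) ⟩
  sumᶠ (λ j → c j * x j) - sumᶠ (λ j → c j * y j) - sumᶠ (λ j → c j * z j) * a ∎
  where
  open ≡-Reasoning
  distribute : ∀ c x y z a → c * (x - y - z * a) ≡ (c * x - c * y) - c * z * a
  distribute = solve-∀

sumᶠ-punchIn : ∀ {r} (f : Fin (suc r) → ℤ) (j : Fin (suc r)) →
  sumᶠ f ≡ f j + sumᶠ (λ i → f (punchIn j i))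
sumᶠ-punchIn          f zero    = refl
sumᶠ-punchIn {suc r} f (suc j) =
  trans (cong (_+_ (f zero)) (sumᶠ-punchIn (λ i → f (suc i)) j))
        (left-comm (f zero) (f (suc j)) _)
  where
  left-comm : ∀ x y s → x + (y + s) ≡ y + (x + s)
  left-comm = solve-∀

∣-lincomb : ∀ {r} {k : ℤ} (c f : Fin r → ℤ) →
  (∀ i → k ∣ f i) → k ∣ sumᶠ (λ i → c i * f i)
∣-lincomb {ℕ.zero} c f k∣f = divides (+ 0) refl
∣-lincomb {suc r}  c f k∣f =
  ∣m∣n⇒∣m+n (∣n⇒∣m*n (c zero) (k∣f zero))
            (∣-lincomb (λ i → c (suc i)) (λ i → f (suc i)) (λ i → k∣f (suc i)))

sumᶠ-δ : ∀ {r} (c : Fin r → ℤ) (i : Fin r) → sumᶠ (λ j → c j * e j i) ≡ c i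
sumᶠ-δ {suc r} c zero =
  trans (cong (_+_ (c zero * + 1)) (sumᶠ-vanishing (λ j → *-zeroʳ (c (suc j)))))
        (unit (c zero))
  where
  unit : ∀ x → x * + 1 + + 0 ≡ x
  unit = solve-∀
sumᶠ-δ {suc r} c (suc i) =
  trans (cong₂ _+_ (*-zeroʳ (c zero)) (sumᶠ-δ (λ j → c (suc j)) i))
        (+-identityˡ (c (suc i)))

-- Number theory: a prime p ∣ m detecting that a ≢ 0 modulo m.

primeDivisor : ∀ n → n ≢ 1 → ∃ λ p → Prime p × p ℕᵈ.∣ n
primeDivisor zero    _   = 2 , prime[2] , 2 ℕᵈ.∣0
primeDivisor (suc n) n≢1
  with PrimeFactorisation.factors (factorise (suc n))
     | PrimeFactorisation.isFactorisation (factorise (suc n))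
     | PrimeFactorisation.factorsPrime (factorise (suc n))
... | []     | n≡1 | _ = ⊥-elim (n≢1 n≡1)
... | q ∷ qs | n≡Π | q-prime ∷ _ =
  q , q-prime , ℕᵈ.divides (product qs) (trans n≡Π (ℕₚ.*-comm q _))

-- Writing A = A'·d and m = m'·d with d = gcd(A, m) > 0: the cofactor m' is
-- a divisor of m, different from 1 when m ∤ A, and m ∣ A·X forces m' ∣ X.
cofactor-by-gcd : ∀ A m d → GCD A m (suc d) → ¬ m ℕᵈ.∣ A →
  ∃ λ m' → m' ≢ 1 × m' ℕᵈ.∣ m × (∀ X → m ℕᵈ.∣ A ℕ.* X → m' ℕᵈ.∣ X)
cofactor-by-gcd .(A' ℕ.* suc d) .(m' ℕ.* suc d) d
                gcd@(GCD.is (ℕᵈ.divides A' refl , ℕᵈ.divides m' refl) _) m∤A =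
  m' , m'≢1 , ℕᵈ.m∣m*n (suc d) , m'∣X
  where
  coprime : GCD A' m' 1
  coprime = GCD-* (subst (GCD _ _) (sym (ℕₚ.*-identityˡ (suc d))) gcd)
  m'≢1 : m' ≢ 1
  m'≢1 refl = m∤A (ℕᵈ.divides A' (cong (A' ℕ.*_) (sym (ℕₚ.*-identityˡ (suc d)))))
  swap : ∀ x y z → x ℕ.* y ℕ.* z ≡ x ℕ.* z ℕ.* y
  swap = ℕRing.solve-∀
  m'∣X : ∀ X → m' ℕ.* suc d ℕᵈ.∣ A' ℕ.* suc d ℕ.* X → m' ℕᵈ.∣ X
  m'∣X X m∣AX =
    coprime-divisor (coprime-sym (GCD≡1⇒coprime coprime))
      (ℕᵈ.*-cancelʳ-∣ (suc d) (subst (m' ℕ.* suc d ℕᵈ.∣_) (swap A' (suc d) X) m∣AX))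

annihilatingPrime : ∀ A m → ¬ m ℕᵈ.∣ A →
  ∃ λ p → Prime p × p ℕᵈ.∣ m × (∀ X → m ℕᵈ.∣ A ℕ.* X → p ℕᵈ.∣ X)
annihilatingPrime A m m∤A with mkGCD A m
... | zero , gcd = ⊥-elim (m∤A (subst (m ℕᵈ.∣_) (sym A≡0) (m ℕᵈ.∣0)))
  where
  A≡0 : A ≡ 0
  A≡0 = ℕᵈ.0∣⇒≡0 (proj₁ (GCD.commonDivisor gcd))
... | suc d , gcd with cofactor-by-gcd A m d gcd m∤A
... | m' , m'≢1 , m'∣m , m'∣X with primeDivisor m' m'≢1
... | p , p-prime , p∣m' =
  p , p-prime , ℕᵈ.∣-trans p∣m' m'∣m , λ X m∣AX → ℕᵈ.∣-trans p∣m' (m'∣X X m∣AX)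

annihilatingPrimeℤ : ∀ m a → ¬ IsZeroMod m a →
  ∃ λ p → Prime p × (+ p) ∣ (+ m) × (∀ X → (+ m) ∣ a * X → (+ p) ∣ X)
annihilatingPrimeℤ m a a≢0 with annihilatingPrime ∣ a ∣ m m∤a
  where
  m∤a : ¬ m ℕᵈ.∣ ∣ a ∣
  m∤a m∣a = a≢0 (subst (λ z → m ℕᵈ.∣ ∣ z ∣) (sym (+-identityʳ a)) m∣a)
... | p , p-prime , p∣m , p∣X =
  p , p-prime , ∣ᵤ⇒∣ p∣m ,
  λ X m∣aX → ∣ᵤ⇒∣ (p∣X ∣ X ∣ (subst (m ℕᵈ.∣_) (abs-* a X) (∣⇒∣ᵤ m∣aX)))

prime∤1 : ∀ {p} → Prime p → ¬ (+ p) ∣ (+ 1)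
prime∤1 p-prime p∣1 with prime⇒nonTrivial (subst Prime (ℕᵈ.∣1⇒≡1 (∣⇒∣ᵤ p∣1)) p-prime)
... | ()

prime∤* : ∀ {p} → Prime p → ∀ {x y} → ¬ (+ p) ∣ x → ¬ (+ p) ∣ y → ¬ (+ p) ∣ x * y
prime∤* {p} p-prime {x} {y} p∤x p∤y p∣xy
  with euclidsLemma ∣ x ∣ ∣ y ∣ p-prime (subst (p ℕᵈ.∣_) (abs-* x y) (∣⇒∣ᵤ p∣xy))
... | inj₁ p∣x = p∤x (∣ᵤ⇒∣ p∣x)
... | inj₂ p∣y = p∤y (∣ᵤ⇒∣ p∣y)

-- Linear algebra modulo a prime p, with integer representatives.

-- The family w spans (ℤ/pℤ)ⁿ up to the scalar u: for every vector v, u·v is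
-- congruent modulo p to an integer combination of the w j.
ScaledSpan : ℕ → ∀ {n r} → (Fin r → Fin n → ℤ) → ℤ → Set
ScaledSpan p {n} {r} w u =
  ∀ (v : Fin n → ℤ) → ∃ λ (c : Fin r → ℤ) →
    ∀ i → (+ p) ∣ u * v i - sumᶠ (λ j → c j * w j i)

-- If u ≢ 0 (mod p), some member of a spanning family has a first
-- coordinate ≢ 0 (mod p); otherwise u·e₀ could not be spanned.
pivot : ∀ {p n r} {w : Fin r → Fin (suc n) → ℤ} {u} →
  ¬ (+ p) ∣ u → ScaledSpan p w u → ∃ λ j → ¬ (+ p) ∣ w j zero
pivot {p} {r = r} {w} {u} p∤u span =
  ¬∀⟶∃¬ r _ (λ j → (+ p) ∣? w j zero) (λ p∣w → p∤u (p∣u p∣w))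
  where
  c : Fin r → ℤ
  c = proj₁ (span (e zero))
  p∣u : (∀ j → (+ p) ∣ w j zero) → (+ p) ∣ u
  p∣u p∣w = begin
    + p                                                    ∣⟨ p∣sum ⟩
    u * + 1 - Σ + Σ                                        ≡⟨ cancel u Σ ⟩
    u                                                      ∎
    where
    open ∣-Reasoning
    Σ : ℤ
    Σ = sumᶠ (λ j → c j * w j zero)
    p∣sum : (+ p) ∣ u * + 1 - Σ + Σ
    p∣sum = ∣m∣n⇒∣m+n (proj₂ (span (e zero)) zero) (∣-lincomb c _ p∣w)
    cancel : ∀ x s → x * + 1 - s + s ≡ x
    cancel = solve-∀

-- Eliminating the first coordinate with pivot vector w j: the vectors
-- b·w i − (w i)₀·w j (i ≠ j, b = (w j)₀), without their first coordinate.
eliminate : ∀ {n r} → (Fin (suc r) → Fin (suc n) → ℤ) → Fin (suc r) → Fin r → Fin n → ℤ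
eliminate w j i x = w j zero * w (punchIn j i) (suc x) - w (punchIn j i) zero * w j (suc x)

eliminate-span : ∀ {p n r} {w : Fin (suc r) → Fin (suc n) → ℤ} {u} (j : Fin (suc r)) →
  ScaledSpan p w u → ScaledSpan p (eliminate w j) (u * w j zero)
eliminate-span {p} {n} {r} {w} {u} j span v' = (λ i → c (punchIn j i)) , p∣reduced
  where
  v : Fin (suc n) → ℤ
  v zero    = + 0
  v (suc x) = v' x
  c : Fin (suc r) → ℤ
  c = proj₁ (span v)
  p∣D : ∀ y → (+ p) ∣ u * v y - sumᶠ (λ k → c k * w k y)
  p∣D = proj₂ (span v)
  b : ℤ
  b = w j zero
  T : Fin (suc n) → ℤ
  T y = sumᶠ (λ i → c (punchIn j i) * w (punchIn j i) y)
  reduced-sum : ∀ x →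
    sumᶠ (λ i → c (punchIn j i) * eliminate w j i x) ≡ b * T (suc x) - T zero * w j (suc x)
  reduced-sum x = begin
    sumᶠ (λ i → c (punchIn j i) * eliminate w j i x)
      ≡⟨ sumᶠ-cong (λ i → distribute (c (punchIn j i)) b _ _ _) ⟩
    sumᶠ (λ i → b * (c (punchIn j i) * w (punchIn j i) (suc x))
                - c (punchIn j i) * w (punchIn j i) zero * w j (suc x))
      ≡⟨ sumᶠ-sub {r} _ _ ⟩
    sumᶠ (λ i → b * (c (punchIn j i) * w (punchIn j i) (suc x)))
      - sumᶠ (λ i → c (punchIn j i) * w (punchIn j i) zero * w j (suc x))
      ≡⟨ cong₂ _-_ (sumᶠ-*ˡ {r} b _) (sumᶠ-*ʳ {r} _ (w j (suc x))) ⟩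
    b * T (suc x) - T zero * w j (suc x) ∎
    where
    open ≡-Reasoning
    distribute : ∀ c b y z t → c * (b * y - z * t) ≡ b * (c * y) - c * z * t
    distribute = solve-∀
  p∣reduced : ∀ x → (+ p) ∣ u * b * v' x - sumᶠ (λ i → c (punchIn j i) * eliminate w j i x)
  p∣reduced x = begin
    + p
      ∣⟨ ∣m∣n⇒∣m-n (∣n⇒∣m*n b (p∣D (suc x))) (∣m⇒∣m*n (w j (suc x)) (p∣D zero)) ⟩
    b * (u * v' x - sumᶠ (λ k → c k * w k (suc x)))
      - (u * + 0 - sumᶠ (λ k → c k * w k zero)) * w j (suc x)
      ≡⟨ cong₂ (λ s₁ s₀ → b * (u * v' x - s₁) - (u * + 0 - s₀) * w j (suc x))
               (sumᶠ-punchIn (λ k → c k * w k (suc x)) j)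
               (sumᶠ-punchIn (λ k → c k * w k zero) j) ⟩
    b * (u * v' x - (c j * w j (suc x) + T (suc x)))
      - (u * + 0 - (c j * b + T zero)) * w j (suc x)
      ≡⟨ pivot-cancels u b (v' x) (c j) (w j (suc x)) (T (suc x)) (T zero) ⟩
    u * b * v' x - (b * T (suc x) - T zero * w j (suc x))
      ≡⟨ cong (_-_ (u * b * v' x)) (sym (reduced-sum x)) ⟩
    u * b * v' x - sumᶠ (λ i → c (punchIn j i) * eliminate w j i x) ∎
    where
    open ∣-Reasoning
    pivot-cancels : ∀ u b v cj t T₁ T₀ →
      b * (u * v - (cj * t + T₁)) - (u * + 0 - (cj * b + T₀)) * t ≡ u * b * v - (b * T₁ - T₀ * t)
    pivot-cancels = solve-∀

spanning-bound : ∀ {p n r} {w : Fin r → Fin n → ℤ} {u} → Prime p →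
  ¬ (+ p) ∣ u → ScaledSpan p w u → n ≤ r
spanning-bound {n = zero}                  p-prime p∤u span = z≤n
spanning-bound {n = suc n} {r = zero} {w}  p-prime p∤u span with pivot {w = w} p∤u span
... | () , _
spanning-bound {p} {suc n} {suc r} {w} {u} p-prime p∤u span =
  eliminate-pivot (pivot {w = w} p∤u span)
  where
  eliminate-pivot : (∃ λ j → ¬ (+ p) ∣ w j zero) → suc n ≤ suc r
  eliminate-pivot (j , p∤b) =
    s≤s (spanning-bound {w = eliminate w j} {u = u * w j zero} p-prime
           (prime∤* p-prime p∤u p∤b) (eliminate-span {w = w} {u = u} j span))

≡[]⇒∣ : ∀ {m} x y → x ≡[ m ] y → (+ m) ∣ x - y
≡[]⇒∣ x y = ∣ᵤ⇒∣

≡⇒≡[] : ∀ {m x y} → x ≡ y → x ≡[ m ] y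
≡⇒≡[] {m} {x} refl = subst (λ z → m ℕᵈ.∣ ∣ z ∣) (sym (+-inverseʳ x)) (m ℕᵈ.∣0)

ideal-refl : ∀ {m} a x → InIdeal m a (x - x)
ideal-refl a x = + 0 , ≡⇒≡[] (self-diff x a)
  where
  self-diff : ∀ x a → x - x ≡ + 0 * a
  self-diff = solve-∀

ideal-sym : ∀ {m} a x y → InIdeal m a (x - y) → InIdeal m a (y - x)
ideal-sym {m} a x y (r , x~y) = - r , ∣⇒∣ᵤ (begin
  + m                     ∣⟨ ∣m⇒∣-m (≡[]⇒∣ (x - y) (r * a) x~y) ⟩
  - (x - y - r * a)       ≡⟨ negate x y r a ⟩
  y - x - (- r) * a       ∎)
  where
  open ∣-Reasoning
  negate : ∀ x y r a → - (x - y - r * a) ≡ y - x - (- r) * a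
  negate = solve-∀

ideal-trans : ∀ {m} a x y z →
  InIdeal m a (x - y) → InIdeal m a (y - z) → InIdeal m a (x - z)
ideal-trans {m} a x y z (r , x~y) (s , y~z) = r + s , ∣⇒∣ᵤ (begin
  + m
    ∣⟨ ∣m∣n⇒∣m+n (≡[]⇒∣ (x - y) (r * a) x~y) (≡[]⇒∣ (y - z) (s * a) y~z) ⟩
  (x - y - r * a) + (y - z - s * a)
    ≡⟨ telescope x y z r s a ⟩
  x - z - (r + s) * a ∎)
  where
  open ∣-Reasoning
  telescope : ∀ x y z r s a → (x - y - r * a) + (y - z - s * a) ≡ x - z - (r + s) * a
  telescope = solve-∀

spline-walk : ∀ {m a n} {E : Graph n} (f : Labeling n) → IsSpline m a E f →
  ∀ {u v} → Star (Adj E) u v → InIdeal m a (f u - f v)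
spline-walk {a = a} f sp {u} ε = ideal-refl a (f u)
spline-walk {a = a} f sp {u} {v} (_◅_ {j = w} (inj₁ uw) walk) =
  ideal-trans a (f u) (f w) (f v) (sp uw) (spline-walk f sp walk)
spline-walk {a = a} f sp {u} {v} (_◅_ {j = w} (inj₂ wu) walk) =
  ideal-trans a (f u) (f w) (f v) (ideal-sym a (f w) (f u) (sp wu)) (spline-walk f sp walk)

exact-spline : ∀ {m a n} {E : Graph n} (f t : Labeling n) →
  (∀ u v → f u - f v ≡ (t u - t v) * a) → IsSpline m a E f
exact-spline f t diff {u} {v} _ = t u - t v , ≡⇒≡[] (diff u v)

e-inject₁ : ∀ {k} (i j : Fin k) → e (inject₁ i) (inject₁ j) ≡ e i j
e-inject₁ zero    zero    = refl
e-inject₁ zero    (suc j) = refl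
e-inject₁ (suc i) zero    = refl
e-inject₁ (suc i) (suc j) = e-inject₁ i j

e-last : ∀ {k} (i : Fin k) → e (inject₁ i) (fromℕ k) ≡ + 0
e-last zero    = refl
e-last (suc i) = e-last i

inject₁-or-last : ∀ {k} (i : Fin (suc k)) → (∃ λ j → i ≡ inject₁ j) ⊎ i ≡ fromℕ k
inject₁-or-last {zero}  zero    = inj₂ refl
inject₁-or-last {suc k} zero    = inj₁ (zero , refl)
inject₁-or-last {suc k} (suc i) with inject₁-or-last i
... | inj₁ (j , i≡j) = inj₁ (suc j , cong suc i≡j)
... | inj₂ i≡last    = inj₂ (cong suc i≡last)

combination-inject : ∀ {k} a (c : Fin (suc k) → ℤ) (i : Fin k) →
  sumᶠ (λ j → c j * stdGens a j (inject₁ i)) ≡ c zero * + 1 + c (suc i) * a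
combination-inject a c i = cong (_+_ (c zero * + 1)) (begin
  sumᶠ (λ j → c (suc j) * (a * e (inject₁ j) (inject₁ i)))
    ≡⟨ sumᶠ-cong (λ j → trans (cong (λ δ → c (suc j) * (a * δ)) (e-inject₁ j i))
                              (reassoc (c (suc j)) a (e j i))) ⟩
  sumᶠ (λ j → c (suc j) * a * e j i)
    ≡⟨ sumᶠ-δ (λ j → c (suc j) * a) i ⟩
  c (suc i) * a ∎)
  where
  open ≡-Reasoning
  reassoc : ∀ x a δ → x * (a * δ) ≡ x * a * δ
  reassoc = solve-∀

combination-last : ∀ {k} a (c : Fin (suc k) → ℤ) →
  sumᶠ (λ j → c j * stdGens a j (fromℕ k)) ≡ c zero
combination-last {k} a c =
  trans (cong (_+_ (c zero * + 1)) (sumᶠ-vanishing vanishes)) (unit (c zero))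
  where
  vanishes : ∀ (j : Fin k) → c (suc j) * (a * e (inject₁ j) (fromℕ k)) ≡ + 0
  vanishes j = trans (cong (λ δ → c (suc j) * (a * δ)) (e-last j)) (annihilate (c (suc j)) a)
    where
    annihilate : ∀ x a → x * (a * + 0) ≡ + 0
    annihilate = solve-∀
  unit : ∀ x → x * + 1 + + 0 ≡ x
  unit = solve-∀

stdGens-splines : ∀ {m a k} {E : Graph (suc k)} j → IsSpline m a E (stdGens a j)
stdGens-splines {a = a} zero    = exact-spline one (λ _ → + 0) (λ _ _ → constant a)
  where
  constant : ∀ a → + 1 - + 1 ≡ (+ 0 - + 0) * a
  constant = solve-∀
stdGens-splines {a = a} (suc j) =
  exact-spline (stdGens a (suc j)) (e (inject₁ j))
    (λ u v → scaled a (e (inject₁ j) u) (e (inject₁ j) v))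
  where
  scaled : ∀ a x y → a * x - a * y ≡ (x - y) * a
  scaled = solve-∀

stdGens-span : ∀ {m a k} {E : Graph (suc k)} {f : Labeling (suc k)} → Connected E →
  IsSpline m a E f → InSpan m (stdGens a) f
stdGens-span {m} {a} {k} {E} {f} conn sp = c , f≡combination
  where
  last : Fin (suc k)
  last = fromℕ k
  to-last : ∀ i → InIdeal m a (f i - f last)
  to-last i = spline-walk f sp (conn i last)
  c : Fin (suc k) → ℤ
  c zero    = f last
  c (suc j) = proj₁ (to-last (inject₁ j))
  f≡combination : ∀ i → f i ≡[ m ] sumᶠ (λ j → c j * stdGens a j i)
  f≡combination i with inject₁-or-last i
  ... | inj₂ refl = ≡⇒≡[] (sym (combination-last a c))
  ... | inj₁ (j , refl) = ∣⇒∣ᵤ (begin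
    + m
      ∣⟨ ∣ᵤ⇒∣ (proj₂ (to-last (inject₁ j))) ⟩
    f (inject₁ j) - f last - c (suc j) * a
      ≡⟨ regroup (f (inject₁ j)) (f last) (c (suc j)) a ⟩
    f (inject₁ j) - (c zero * + 1 + c (suc j) * a)
      ≡⟨ cong (_-_ (f (inject₁ j))) (sym (combination-inject a c j)) ⟩
    f (inject₁ j) - sumᶠ (λ l → c l * stdGens a l (inject₁ j)) ∎)
    where
    open ∣-Reasoning
    regroup : ∀ x y r a → x - y - r * a ≡ x - (y * + 1 + r * a)
    regroup = solve-∀

stdGens-generate : ∀ {m a k} {E : Graph (suc k)} → Connected E → Generates m a E (stdGens a)
stdGens-generate conn = stdGens-splines , λ f sp → stdGens-span {f = f} conn sp

-- Lower bound: coordinates of splines modulo p.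

module Coordinates
  {m : ℕ} {a : ℤ} {p : ℕ}
  (p∣m : (+ p) ∣ (+ m))
  (cancel-a : ∀ X → (+ m) ∣ a * X → (+ p) ∣ X)
  {k : ℕ} {E : Graph (suc k)} (conn : Connected E)
  where

  slope : ∀ f → IsSpline m a E f → Fin (suc k) → ℤ
  slope f sp i = proj₁ (spline-walk f sp (conn i zero))

  slope-spec : ∀ f (sp : IsSpline m a E f) i → (+ m) ∣ f i - f zero - slope f sp i * a
  slope-spec f sp i = ∣ᵤ⇒∣ (proj₂ (spline-walk f sp (conn i zero)))

  coords : ∀ f → IsSpline m a E f → Fin (suc k) → ℤ
  coords f sp zero    = f zero
  coords f sp (suc x) = slope f sp (suc x)

  coords-linear : ∀ {r f} {g : Fin r → Labeling (suc k)}
    (sp : IsSpline m a E f) (sps : ∀ j → IsSpline m a E (g j)) (c : Fin r → ℤ) →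
    (∀ i → f i ≡[ m ] sumᶠ (λ j → c j * g j i)) →
    ∀ i → (+ p) ∣ coords f sp i - sumᶠ (λ j → c j * coords (g j) (sps j) i)
  coords-linear {f = f} {g} sp sps c f≡ zero =
    ∣-trans p∣m (≡[]⇒∣ (f zero) (sumᶠ (λ j → c j * g j zero)) (f≡ zero))
  coords-linear {r} {f} {g} sp sps c f≡ (suc x) = cancel-a _ (begin
    + m
      ∣⟨ ∣m∣n⇒∣m+n (∣m∣n⇒∣m-n (∣m∣n⇒∣m-n m∣fᵢ m∣f₀) (slope-spec f sp i)) m∣slopes ⟩
    (f i - G i) - (f zero - G zero) - (f i - f zero - σ * a)
      + sumᶠ (λ j → c j * (g j i - g j zero - S j * a))
      ≡⟨ cong (_+_ ((f i - G i) - (f zero - G zero) - (f i - f zero - σ * a)))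
              (sumᶠ-lincomb-diff c (λ j → g j i) (λ j → g j zero) S a) ⟩
    (f i - G i) - (f zero - G zero) - (f i - f zero - σ * a) + (G i - G zero - Σ * a)
      ≡⟨ collect (f i) (f zero) (G i) (G zero) σ Σ a ⟩
    a * (σ - Σ) ∎)
    where
    open ∣-Reasoning
    i : Fin (suc k)
    i = suc x
    G : Fin (suc k) → ℤ
    G y = sumᶠ (λ j → c j * g j y)
    σ : ℤ
    σ = slope f sp i
    S : Fin r → ℤ
    S j = slope (g j) (sps j) i
    Σ : ℤ
    Σ = sumᶠ (λ j → c j * S j)
    m∣fᵢ : (+ m) ∣ f i - G i
    m∣fᵢ = ≡[]⇒∣ (f i) (G i) (f≡ i)
    m∣f₀ : (+ m) ∣ f zero - G zero
    m∣f₀ = ≡[]⇒∣ (f zero) (G zero) (f≡ zero)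
    m∣slopes : (+ m) ∣ sumᶠ (λ j → c j * (g j i - g j zero - S j * a))
    m∣slopes = ∣-lincomb {r} c _ (λ j → slope-spec (g j) (sps j) i)
    collect : ∀ fᵢ f₀ Gᵢ G₀ σ Σ a →
      (fᵢ - Gᵢ) - (f₀ - G₀) - (fᵢ - f₀ - σ * a) + (Gᵢ - G₀ - Σ * a) ≡ a * (σ - Σ)
    collect = solve-∀

  -- Every integer vector v is, modulo p, the coordinate vector of the
  -- spline y ↦ v₀ + a·t(y), where t agrees with v off v₀ and t(v₀) = 0.
  coords-surjective : ∀ (v : Fin (suc k) → ℤ) →
    ∃ λ f → ∃ λ (sp : IsSpline m a E f) → ∀ i → (+ p) ∣ v i - coords f sp i
  coords-surjective v = f , sp , v≡coords
    where
    t : Fin (suc k) → ℤ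
    t zero    = + 0
    t (suc x) = v (suc x)
    f : Labeling (suc k)
    f y = v zero + a * t y
    sp : IsSpline m a E f
    sp = exact-spline f t (λ u w → shifted (v zero) a (t u) (t w))
      where
      shifted : ∀ v₀ a x y → v₀ + a * x - (v₀ + a * y) ≡ (x - y) * a
      shifted = solve-∀
    v≡coords : ∀ i → (+ p) ∣ v i - coords f sp i
    v≡coords zero = begin
      + p                        ∣⟨ divides (+ 0) refl ⟩
      + 0                        ≡⟨ no-shift (v zero) a ⟩
      v zero - (v zero + a * + 0) ∎
      where
      open ∣-Reasoning
      no-shift : ∀ v₀ a → + 0 ≡ v₀ - (v₀ + a * + 0)
      no-shift = solve-∀
    v≡coords (suc x) = cancel-a _ (begin
      + m                                                   ∣⟨ slope-spec f sp (suc x) ⟩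
      v zero + a * v (suc x) - (v zero + a * + 0) - σ * a   ≡⟨ factor (v zero) a (v (suc x)) σ ⟩
      a * (v (suc x) - σ)                                   ∎)
      where
      open ∣-Reasoning
      σ : ℤ
      σ = slope f sp (suc x)
      factor : ∀ v₀ a y σ → v₀ + a * y - (v₀ + a * + 0) - σ * a ≡ a * (y - σ)
      factor = solve-∀

  generators-span : ∀ {r} {g : Fin r → Labeling (suc k)} (gen : Generates m a E g) →
    ScaledSpan p (λ j → coords (g j) (proj₁ gen j)) (+ 1)
  generators-span {g = g} (sps , spans) v with coords-surjective v
  ... | f , sp , v≡coords with spans f sp
  ... | c , f≡ = c , λ i → begin
    + p
      ∣⟨ ∣m∣n⇒∣m+n (v≡coords i) (coords-linear sp sps c f≡ i) ⟩
    (v i - coords f sp i) + (coords f sp i - Σ i)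
      ≡⟨ telescope (v i) (coords f sp i) (Σ i) ⟩
    + 1 * v i - Σ i ∎
    where
    Σ : Fin (suc k) → ℤ
    Σ i = sumᶠ (λ j → c j * coords (g j) (sps j) i)
    open ∣-Reasoning
    telescope : ∀ x y z → (x - y) + (y - z) ≡ + 1 * x - z
    telescope = solve-∀

mainTheorem14 : (m : ℕ) (a : ℤ) → ¬ IsZeroMod m a → ¬ IsUnitMod m a →
    (k : ℕ) (E : Graph (suc k)) → Connected E →
    Generates m a E (stdGens a)
    × (∀ (r : ℕ) (g : Fin r → Labeling (suc k)) → Generates m a E g → suc k ≤ r)
mainTheorem14 m a a≢0 _ k E conn = stdGens-generate conn , minimality
  where
  minimality : ∀ r (g : Fin r → Labeling (suc k)) → Generates m a E g → suc k ≤ r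
  minimality r g gen with annihilatingPrimeℤ m a a≢0
  ... | p , p-prime , p∣m , cancel-a =
    spanning-bound p-prime (prime∤1 p-prime) (Coordinates.generators-span p∣m cancel-a conn gen)
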